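{- If a multiparty session $\mathcal{M}$ is well typed, i.e. $\vdash\mathcal{M}:\mathsf{G}$ for some well-formed global type $\mathsf{G}$, then $\mathcal{M}$ is lock-free.
   Context: Processes are possibly infinite regular trees (finitely many distinct subtrees) generated coinductively by $P ::= \mathbf{0}\mid \mathsf{p}?\Lambda\mid \mathsf{p}!\Lambda$ with $\Lambda=\{\ell_1.P_1,\dots,\ell_n.P_n\}$ ($n\ge1$, distinct messages); $\mathsf{p}?\Lambda$ is input from $\mathsf{p}$, $\mathsf{p}!\Lambda$ output to $\mathsf{p}$. $\mathrm{lab}(\Lambda)$ is its set of messages; $\ell.P\oplus\Lambda$ is $\{\ell.P\}\cup\Lambda$ with $\ell\notin\mathrm{lab}(\Lambda)$, $\Lambda_1\oplus\Lambda_2$ a union with disjoint label sets. $\mathrm{pt}(P)$ is the set of participants in $P$. A multiparty session is $\prod_{i\in I}\mathsf{p}_i[P_i]$ with distinct $\mathsf{p}_i\notin\mathrm{pt}(P_i)$. $\equiv$ makes $\mid$ commutative, associative with neutral $\mathsf{p}[\mathbf{0}]$ (any fresh $\mathsf{p}$). Reduction is the closure under $\equiv$ of: if $\mathrm{lab}(\Lambda)\subseteq\mathrm{lab}(\Lambda')$ then $\mathsf{p}[\mathsf{q}!(\ell.P\oplus\Lambda)]\mid\mathsf{q}[\mathsf{p}?(\ell.Q\oplus\Lambda')]\mid\mathcal{M}\xrightarrow{\mathsf{p}\ell\mathsf{q}}\mathsf{p}[P]\mid\mathsf{q}[Q]\mid\mathcal{M}$; $\to^*$ is the reflexive transitive closure.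 $\mathcal{M}$ is lock-free if (a) $\mathcal{M}\to^*\mathcal{M}'$ implies $\mathcal{M}'\equiv\mathsf{p}[\mathbf{0}]$ or $\mathcal{M}'\to\mathcal{M}''$ for some $\mathcal{M}''$; and (b) $\mathcal{M}\to^*\mathsf{p}[P]\mid\mathcal{M}'$ with $P\neq\mathbf{0}$ implies $\mathsf{p}[P]\mid\mathcal{M}'\to^*\mathcal{M}''\xrightarrow{\lambda}$ for some $\mathcal{M}''$ and label $\lambda=\mathsf{r}\ell\mathsf{s}$ in which $\mathsf{p}\in\{\mathsf{r},\mathsf{s}\}$. Global types: regular trees generated coinductively by $\mathsf{G}::=\mathtt{end}\mid\mathsf{p}\to\mathsf{q}:\{\ell_i.\mathsf{G}_i\}_{i\le n}$ (distinct messages); $\mathrm{pt}(\mathsf{G})$ its participants. Projection (partial, coinductive): $\mathsf{G}\!\upharpoonright\!\mathsf{p}=\mathbf{0}$ if $\mathsf{p}\notin\mathrm{pt}(\mathsf{G})$; $(\mathsf{p}\to\mathsf{q}:\{\ell_i.\mathsf{G}_i\})\!\upharpoonright\!\mathsf{p}=\mathsf{q}!\{\ell_i.(\mathsf{G}_i\!\upharpoonright\!\mathsf{p})\}$; $(\mathsf{q}\to\mathsf{p}:\{\ell_i.\mathsf{G}_i\})\!\upharpoonright\!\mathsf{p}=\mathsf{q}?\{\ell_i.(\mathsf{G}_i\!\upharpoonright\!\mathsf{p})\}$; for $\mathsf{p}\notin\{\mathsf{q},\mathsf{r}\}$, $(\mathsf{q}\to\mathsf{r}:\{\ell_i.\mathsf{G}_i\}_{i\le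 n})\!\upharpoonright\!\mathsf{p}$ is $\mathsf{G}_1\!\upharpoonright\!\mathsf{p}$ if all $\mathsf{G}_i\!\upharpoonright\!\mathsf{p}$ coincide, is $\mathsf{s}?(\Lambda_1\oplus\cdots\oplus\Lambda_n)$ if $\mathsf{G}_i\!\upharpoonright\!\mathsf{p}=\mathsf{s}?\Lambda_i$ for all $i$ with pairwise disjoint label sets, undefined otherwise. For a path $\pi$ of $\mathsf{G}$ from the root, $d(\pi,\mathsf{p})$ is the number of communications before the first one involving $\mathsf{p}$ (the length of $\pi$, possibly $\infty$, if none); the weight of $\mathsf{p}$ in $\mathsf{G}$ is $\sup_\pi d(\pi,\mathsf{p})$ if $\mathsf{p}\in\mathrm{pt}(\mathsf{G})$, else $0$. $\mathsf{G}$ is well formed if each $\mathsf{p}\in\mathrm{pt}(\mathsf{G})$ has finite weight and defined projection. Structural preorder $\leqslant$: largest relation with $P\leqslant Q$ implying $P=Q=\mathbf{0}$, or $P=\mathsf{p}?(\{\ell_i.P_i\}_{i\le n}\oplus\Lambda)$, $Q=\mathsf{p}?\{\ell_i.Q_i\}_{i\le n}$, $P_i\leqslant Q_i$, or $P=\mathsf{p}!\{\ell_i.P_i\}_{i\le n}$, $Q=\mathsf{p}!\{\ell_i.Q_i\}_{i\le n}$, $P_i\leqslant Q_i$. Typing: $\vdash\prod_{i\in I}\mathsf{p}_i[P_i]:\mathsf{G}$ iff $P_i\leqslant\mathsf{G}\!\upharpoonright\!\mathsf{p}_i$ for all $i$ and $\mathrm{pt}(\mathsf{G})\subseteq\{\mathsf{p}_i\}_{i\in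 I}$. -}

module Defs where

open import Level using (0ℓ) renaming (suc to lsuc)
open import Data.Nat using (ℕ; suc; _≤_; _<_; _≟_)
open import Data.Fin using (Fin)
open import Data.Product using (Σ; ∃; ∃-syntax; _×_; _,_; proj₁; proj₂)
open import Data.Sum using (_⊎_)
open import Data.Bool using (if_then_else_)
open import Data.List using (List; []; _∷_; map; length; lookup)
open import Data.List.Membership.Propositional using (_∈_; _∉_)
open import Data.List.Relation.Unary.Unique.Propositional using (Unique)
open import Relation.Nullary using (¬_)
open import Relation.Nullary.Decidable using (does)
open import Relation.Binary.PropositionalEquality using (_≡_; _≢_)
open import Relation.Binary.Construct.Closure.ReflexiveTransitive using (Star)

Part : Set
Part = ℕ

Label : Set
Label = ℕ

labs : {A : Set} → List (Label × A) → List Label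
labs = map proj₁

SameLabels : {A B : Set} → List (Label × A) → List (Label × B) → Set
SameLabels bs bs' = (∀ ℓ → ℓ ∈ labs bs → ℓ ∈ labs bs') × (∀ ℓ → ℓ ∈ labs bs' → ℓ ∈ labs bs)

ValidBranches : {A : Set} → List (Label × A) → Set
ValidBranches bs = (0 < length bs) × Unique (labs bs)

map₂ : {A B : Set} → (A → B) → List (Label × A) → List (Label × B)
map₂ f = map (λ b → proj₁ b , f (proj₂ b))

-- A process is a regular tree, i.e. a tree with finitely many distinct
-- subtrees.  Regular trees are represented as the unfolding of a finite
-- rooted graph: states Fin n, each labelled by a node 𝟎, p?Λ or p!Λ
-- whose branches point to states.  Tree equality is bisimilarity (≈P).

data PNode (X : Set) : Set where
  𝟎   : PNode X
  inp : Part → List (Label × X) → PNode X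
  out : Part → List (Label × X) → PNode X

mapPNode : {A B : Set} → (A → B) → PNode A → PNode B
mapPNode f 𝟎 = 𝟎
mapPNode f (inp p bs) = inp p (map₂ f bs)
mapPNode f (out p bs) = out p (map₂ f bs)

ValidPNode : {X : Set} → PNode X → Set
ValidPNode 𝟎 = Level.Lift 0ℓ Data.Unit.⊤ where import Data.Unit
ValidPNode (inp p bs) = ValidBranches bs
ValidPNode (out p bs) = ValidBranches bs

record Proc : Set where
  field
    size  : ℕ
    δ     : Fin size → PNode (Fin size)
    valid : ∀ s → ValidPNode (δ s)
    start : Fin size

atP : (P : Proc) → Fin (Proc.size P) → Proc
atP P s = record P { start = s }

root : Proc → PNode Proc
root P = mapPNode (atP P) (Proc.δ P (Proc.start P))

data _∈pt_ (p : Part) (P : Proc) : Set where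
  here-inp  : ∀ {bs} → root P ≡ inp p bs → p ∈pt P
  here-out  : ∀ {bs} → root P ≡ out p bs → p ∈pt P
  there-inp : ∀ {q bs ℓ Q} → root P ≡ inp q bs → (ℓ , Q) ∈ bs → p ∈pt Q → p ∈pt P
  there-out : ∀ {q bs ℓ Q} → root P ≡ out q bs → (ℓ , Q) ∈ bs → p ∈pt Q → p ∈pt P

data ≈F (R : Proc → Proc → Set) : PNode Proc → PNode Proc → Set where
  𝟎≈   : ≈F R 𝟎 𝟎
  inp≈ : ∀ {p bs bs'} → SameLabels bs bs' →
         (∀ ℓ P Q → (ℓ , P) ∈ bs → (ℓ , Q) ∈ bs' → R P Q) →
         ≈F R (inp p bs) (inp p bs')
  out≈ : ∀ {p bs bs'} → SameLabels bs bs' →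
         (∀ ℓ P Q → (ℓ , P) ∈ bs → (ℓ , Q) ∈ bs' → R P Q) →
         ≈F R (out p bs) (out p bs')

_≈P_ : Proc → Proc → Set₁
P ≈P Q = ∃[ R ] (R P Q × (∀ P' Q' → R P' Q' → ≈F R (root P') (root Q')))

data ⩽F (R : Proc → Proc → Set) : PNode Proc → PNode Proc → Set where
  𝟎⩽   : ⩽F R 𝟎 𝟎
  inp⩽ : ∀ {p bs bs'} →
         (∀ ℓ → ℓ ∈ labs bs' → ℓ ∈ labs bs) →
         (∀ ℓ P Q → (ℓ , P) ∈ bs → (ℓ , Q) ∈ bs' → R P Q) →
         ⩽F R (inp p bs) (inp p bs')
  out⩽ : ∀ {p bs bs'} → SameLabels bs bs' →
         (∀ ℓ P Q → (ℓ , P) ∈ bs → (ℓ , Q) ∈ bs' → R P Q) →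
         ⩽F R (out p bs) (out p bs')

_⩽_ : Proc → Proc → Set₁
P ⩽ Q = ∃[ R ] (R P Q × (∀ P' Q' → R P' Q' → ⩽F R (root P') (root Q')))

-- Multiparty sessions up to ≡.
-- ∏_{i∈I} pᵢ[Pᵢ] modulo ≡ (commutativity, associativity, neutral p[𝟎])
-- is determined by the map sending each participant to its process
-- (𝟎 for participants not in I).  Finiteness of I and pᵢ ∉ pt(Pᵢ) are
-- imposed by IsSession below.

Session : Set
Session = Part → Proc

update : Session → Part → Proc → Part → Proc → Session
update M p P q Q r =
  if does (r ≟ p) then P else (if does (r ≟ q) then Q else M r)

data Step (M : Session) : Part → Label → Part → Session → Set where
  comm : ∀ {p q ℓ bs bs' P Q} →
         p ≢ q →
         root (M p) ≡ out q bs →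
         root (M q) ≡ inp p bs' →
         (ℓ , P) ∈ bs → (ℓ , Q) ∈ bs' →
         (∀ ℓ' → ℓ' ∈ labs bs → ℓ' ∈ labs bs') →
         Step M p ℓ q (update M p P q Q)

_⟶_ : Session → Session → Set
M ⟶ M' = ∃[ p ] ∃[ ℓ ] ∃[ q ] Step M p ℓ q M'

_⟶*_ : Session → Session → Set
_⟶*_ = Star _⟶_

Terminated : Session → Set
Terminated M = ∀ r → root (M r) ≡ 𝟎

LockFree : Session → Set
LockFree M =
  (∀ M' → M ⟶* M' → Terminated M' ⊎ ∃[ M'' ] (M' ⟶ M''))
  ×
  (∀ M' p → M ⟶* M' → ¬ (root (M' p) ≡ 𝟎) →
     ∃[ M'' ] (M' ⟶* M'' × ∃[ r ] ∃[ ℓ ] ∃[ s ] ∃[ M''' ]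
        (Step M'' r ℓ s M''' × (p ≡ r ⊎ p ≡ s))))

-- M is (the ≡-class of) the session ∏_{p∈I} p[M p]
IsSession : Session → List Part → Set
IsSession M I =
  Unique I × (∀ p → p ∉ I → root (M p) ≡ 𝟎) × (∀ p → p ∈ I → ¬ (p ∈pt M p))

-- Global types: regular trees, again as unfoldings of finite rooted graphs

data GNode (X : Set) : Set where
  end : GNode X
  com : Part → Part → List (Label × X) → GNode X

mapGNode : {A B : Set} → (A → B) → GNode A → GNode B
mapGNode f end = end
mapGNode f (com p q bs) = com p q (map₂ f bs)

ValidGNode : {X : Set} → GNode X → Set
ValidGNode end = Level.Lift 0ℓ Data.Unit.⊤ where import Data.Unit
ValidGNode (com p q bs) = ValidBranches bs

record GT : Set where
  field
    size  : ℕ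
    δ     : Fin size → GNode (Fin size)
    valid : ∀ s → ValidGNode (δ s)
    start : Fin size

atG : (G : GT) → Fin (GT.size G) → GT
atG G s = record G { start = s }

groot : GT → GNode GT
groot G = mapGNode (atG G) (GT.δ G (GT.start G))

data _∈ptG_ (p : Part) (G : GT) : Set where
  here-snd : ∀ {q bs} → groot G ≡ com p q bs → p ∈ptG G
  here-rcv : ∀ {q bs} → groot G ≡ com q p bs → p ∈ptG G
  there    : ∀ {q r bs ℓ G'} → groot G ≡ com q r bs → (ℓ , G') ∈ bs → p ∈ptG G' → p ∈ptG G

data Path (G : GT) : Set where
  stop : Path G
  go   : ∀ {q r bs ℓ G'} → groot G ≡ com q r bs → (ℓ , G') ∈ bs → Path G' → Path G

d : (G : GT) → Path G → Part → ℕ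
d G stop p = 0
d G (go {q} {r} {G' = G'} _ _ π) p =
  if does (p ≟ q) then 0 else (if does (p ≟ r) then 0 else suc (d G' π p))

FiniteWeight : GT → Part → Set
FiniteWeight G p = ∃[ n ] (∀ (π : Path G) → d G π p ≤ n)

data ProjF (p : Part) (R : GT → Proc → Set) (G : GT) (P : Proc) : Set₁ where
  proj-none  : ¬ (p ∈ptG G) → root P ≡ 𝟎 → ProjF p R G P
  proj-snd   : ∀ {q bs bs'} → groot G ≡ com p q bs → root P ≡ out q bs' →
               SameLabels bs bs' → (∀ ℓ G' P' → (ℓ , G') ∈ bs → (ℓ , P') ∈ bs' → R G' P') →
               ProjF p R G P
  proj-rcv   : ∀ {q bs bs'} → groot G ≡ com q p bs → root P ≡ inp q bs' →
               SameLabels bs bs' → (∀ ℓ G' P' → (ℓ , G') ∈ bs → (ℓ , P') ∈ bs' → R G' P') →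
               ProjF p R G P
  proj-same  : ∀ {q r bs} → groot G ≡ com q r bs → p ≢ q → p ≢ r → p ∈ptG G →
               (∀ ℓ G' → (ℓ , G') ∈ bs → R G' P) →
               ProjF p R G P
  proj-merge : ∀ {q r bs s bs'} → groot G ≡ com q r bs → p ≢ q → p ≢ r → p ∈ptG G →
               root P ≡ inp s bs' →
               (Ps : Fin (length bs) → Proc) → (Λ : Fin (length bs) → List (Label × Proc)) →
               (∀ i → R (proj₂ (lookup bs i)) (Ps i)) →
               (∀ i → root (Ps i) ≡ inp s (Λ i)) →
               (∀ i j → i ≢ j → ∀ ℓ → ℓ ∈ labs (Λ i) → ℓ ∉ labs (Λ j)) →
               (∀ ℓ → ℓ ∈ labs bs' → ∃[ i ] (ℓ ∈ labs (Λ i))) →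
               (∀ i ℓ → ℓ ∈ labs (Λ i) → ℓ ∈ labs bs') →
               (∀ i ℓ P' P'' → (ℓ , P') ∈ bs' → (ℓ , P'') ∈ Λ i → P' ≈P P'') →
               ProjF p R G P

Proj : Part → GT → Proc → Set₁
Proj p G P = ∃[ R ] (R G P × (∀ G' P' → R G' P' → ProjF p R G' P'))

WellFormed : GT → Set₁
WellFormed G = ∀ p → p ∈ptG G → FiniteWeight G p × ∃[ P ] Proj p G P

Typed : Session → List Part → GT → Set₁
Typed M I G =
  (∀ p → p ∈ I → ∃[ Q ] (Proj p G Q × M p ⩽ Q)) × (∀ p → p ∈ptG G → p ∈ I)

-- Typing is replaced by a coinductive invariant: a session is well typed at
-- a state x of a global-type-like graph when the process of every
-- participant u conforms to x, i.e. lies below the projection of x onto u.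
-- At such a session the top communication r → t of x can fire along any of
-- its branches, and the result is well typed at that branch; following the
-- finite path in x to a participant's first communication therefore lets it
-- act (progress).  Conversely, every step p ℓ q of a well-typed session,
-- not necessarily the top communication of x, yields a session that is well
-- typed at the reduct of x in which the first p → q communication on each
-- path is replaced by its ℓ-continuation (subject reduction).  Hence every
-- reachable session enjoys progress, which is lock-freedom.

module Submission where

open import Level using (Level; Lift; lift; lower)
open import Data.Nat using (_≟_)
open import Data.Maybe using (Maybe; just; nothing; maybe)
open import Data.Product using (Σ-syntax; ∃-syntax; _×_; _,_; proj₁; proj₂)
open import Data.Sum using (_⊎_; inj₁; inj₂)
open import Data.Empty using (⊥-elim)
open import Data.List using (List; []; _∷_)
open import Data.List.Properties using (map-∘)
open import Data.List.Relation.Unary.Any using (here; there; index)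
open import Data.List.Relation.Unary.Any.Properties using (lookup-index)
open import Data.List.Membership.Propositional using (_∈_)
open import Data.List.Membership.Propositional.Properties using (∈-map⁺; ∈-map⁻)
open import Data.List.Membership.DecPropositional _≟_ using (_∈?_)
open import Relation.Nullary using (¬_; Dec; yes; no)
open import Relation.Nullary.Decidable using (dec-true; dec-false)
open import Relation.Binary.PropositionalEquality
open import Relation.Binary.Construct.Closure.ReflexiveTransitive using (ε; _◅_)
open import Function using (_∘_)
open import Defs

module _ {A : Set} where

  label∈labs : ∀ {bs : List (Label × A)} {ℓ a} → (ℓ , a) ∈ bs → ℓ ∈ labs bs
  label∈labs = ∈-map⁺ proj₁

  branch-with-label : ∀ {bs : List (Label × A)} {ℓ} → ℓ ∈ labs bs → ∃[ a ] (ℓ , a) ∈ bs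
  branch-with-label m with ∈-map⁻ proj₁ m
  ... | (_ , a) , m′ , refl = a , m′

  select : Label → List (Label × A) → Maybe A
  select ℓ [] = nothing
  select ℓ ((ℓ′ , a) ∷ bs) with ℓ ≟ ℓ′
  ... | yes _ = just a
  ... | no _  = select ℓ bs

  select-complete : ∀ {ℓ} (bs : List (Label × A)) → ℓ ∈ labs bs →
                    ∃[ a ] (select ℓ bs ≡ just a × (ℓ , a) ∈ bs)
  select-complete {ℓ} ((ℓ′ , a) ∷ bs) m with ℓ ≟ ℓ′
  ... | yes refl = a , refl , here refl
  select-complete ((ℓ′ , a) ∷ bs) (here ℓ≡ℓ′) | no ℓ≢ℓ′ = ⊥-elim (ℓ≢ℓ′ ℓ≡ℓ′)
  select-complete ((ℓ′ , a) ∷ bs) (there m)   | no _ with select-complete bs m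
  ... | a′ , found , m′ = a′ , found , there m′

module _ {A B : Set} (f : A → B) where

  labs-map₂ : (bs : List (Label × A)) → labs (map₂ f bs) ≡ labs bs
  labs-map₂ bs = sym (map-∘ bs)

  ∈-map₂⁺ : ∀ {bs ℓ a} → (ℓ , a) ∈ bs → (ℓ , f a) ∈ map₂ f bs
  ∈-map₂⁺ = ∈-map⁺ _

  ∈-map₂⁻ : ∀ {bs ℓ b} → (ℓ , b) ∈ map₂ f bs → ∃[ a ] ((ℓ , a) ∈ bs × b ≡ f a)
  ∈-map₂⁻ m with ∈-map⁻ _ m
  ... | (_ , a) , m′ , refl = a , m′ , refl

  labs-map₂⊆ : ∀ {C : Set} {bs : List (Label × A)} {cs : List (Label × C)} →
               (∀ ℓ → ℓ ∈ labs bs → ℓ ∈ labs cs) → ∀ ℓ → ℓ ∈ labs (map₂ f bs) → ℓ ∈ labs cs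
  labs-map₂⊆ {bs = bs} sub ℓ m = sub ℓ (subst (ℓ ∈_) (labs-map₂ bs) m)

  SameLabels-map₂ : ∀ {C : Set} {bs : List (Label × A)} {cs : List (Label × C)} →
                    SameLabels bs cs → SameLabels (map₂ f bs) cs
  SameLabels-map₂ {bs = bs} (bs⊆cs , cs⊆bs) =
    labs-map₂⊆ bs⊆cs , λ ℓ m → subst (ℓ ∈_) (sym (labs-map₂ bs)) (cs⊆bs ℓ m)

Branches : ∀ {a : Level} {X : Set} → (X → Set a) → List (Label × X) → Set a
Branches F bs = ∀ {ℓ y} → (ℓ , y) ∈ bs → F y

Conts : ∀ {a : Level} {X : Set} → (X → Proc → Set a) → List (Label × X) → List (Label × Proc) → Set a
Conts R bs bsP = ∀ {ℓ y P} → (ℓ , y) ∈ bs → (ℓ , P) ∈ bsP → R y P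

module _ {a b : Level} {X Y : Set} (f : X → Y) {bs : List (Label × X)} where

  Branches-map₂ : {F : X → Set a} {F′ : Y → Set b} →
                  (∀ {ℓ y} → (ℓ , y) ∈ bs → F y → F′ (f y)) → Branches F bs → Branches F′ (map₂ f bs)
  Branches-map₂ carry k m with ∈-map₂⁻ f m
  ... | _ , m′ , refl = carry m′ (k m′)

  Conts-map₂ : {R : X → Proc → Set a} {R′ : Y → Proc → Set b} {bsP : List (Label × Proc)} →
               (∀ {ℓ y P} → (ℓ , y) ∈ bs → R y P → R′ (f y) P) → Conts R bs bsP → Conts R′ (map₂ f bs) bsP
  Conts-map₂ carry k m mP with ∈-map₂⁻ f m
  ... | _ , m′ , refl = carry m′ (k m′ mP)

𝟎≢inp : ∀ {X : Set} {p} {bs : List (Label × X)} → 𝟎 ≢ inp p bs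
𝟎≢inp ()

𝟎≢out : ∀ {X : Set} {p} {bs : List (Label × X)} → 𝟎 ≢ out p bs
𝟎≢out ()

inp≢out : ∀ {X : Set} {p q} {bs bs′ : List (Label × X)} → inp p bs ≢ out q bs′
inp≢out ()

out-injective : ∀ {X : Set} {p q} {bs bs′ : List (Label × X)} → out p bs ≡ out q bs′ → p ≡ q × bs ≡ bs′
out-injective refl = refl , refl

inp-injective : ∀ {X : Set} {p q} {bs bs′ : List (Label × X)} → inp p bs ≡ inp q bs′ → p ≡ q × bs ≡ bs′
inp-injective refl = refl , refl

𝟎⇒∉pt : ∀ {u P} → root P ≡ 𝟎 → ¬ u ∈pt P
𝟎⇒∉pt z (here-inp e)      = 𝟎≢inp (trans (sym z) e)
𝟎⇒∉pt z (here-out e)      = 𝟎≢out (trans (sym z) e)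
𝟎⇒∉pt z (there-inp e _ _) = 𝟎≢inp (trans (sym z) e)
𝟎⇒∉pt z (there-out e _ _) = 𝟎≢out (trans (sym z) e)

out-has-branch : (P : Proc) → ∀ {t bs} → root P ≡ out t bs → ∃[ ℓ ] ∃[ P′ ] (ℓ , P′) ∈ bs
out-has-branch P = nonempty (Proc.δ P (Proc.start P)) (Proc.valid P (Proc.start P))
  where
  nonempty : ∀ n → ValidPNode n → ∀ {t bs} → mapPNode (atP P) n ≡ out t bs → ∃[ ℓ ] ∃[ P′ ] (ℓ , P′) ∈ bs
  nonempty (out _ ((ℓ , s) ∷ _)) _ refl = ℓ , atP P s , here refl
  nonempty (out _ []) (() , _) _

data ⊑F (S : Proc → Proc → Set₁) : PNode Proc → PNode Proc → Set₁ where
  𝟎⊑   : ⊑F S 𝟎 𝟎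
  inp⊑ : ∀ {p bs bs′} → (∀ ℓ → ℓ ∈ labs bs′ → ℓ ∈ labs bs) → Conts S bs bs′ → ⊑F S (inp p bs) (inp p bs′)
  out⊑ : ∀ {p bs bs′} → SameLabels bs bs′ → Conts S bs bs′ → ⊑F S (out p bs) (out p bs′)

-- The structural preorder with Set₁-valued witnesses, so that it can be
-- composed with bisimilarity ≈P (which lives in Set₁).
_⊑_ : Proc → Proc → Set₂
P ⊑ Q = Σ[ S ∈ (Proc → Proc → Set₁) ] (S P Q × (∀ {A B} → S A B → ⊑F S (root A) (root B)))

⩽⇒⊑ : ∀ {P Q} → P ⩽ Q → P ⊑ Q
⩽⇒⊑ (R , r , closed) = (λ A B → Lift _ (R A B)) , lift r , λ s → lift-⩽F (closed _ _ (lower s))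
  where
  lift-⩽F : ∀ {a b} → ⩽F R a b → ⊑F (λ A B → Lift _ (R A B)) a b
  lift-⩽F 𝟎⩽          = 𝟎⊑
  lift-⩽F (inp⩽ sub k) = inp⊑ sub (λ {ℓ} {P} {Q} mP mQ → lift (k ℓ P Q mP mQ))
  lift-⩽F (out⩽ sl k)  = out⊑ sl (λ {ℓ} {P} {Q} mP mQ → lift (k ℓ P Q mP mQ))

⊑F-𝟎 : ∀ {S a} → ⊑F S a 𝟎 → a ≡ 𝟎
⊑F-𝟎 𝟎⊑ = refl

⊑F-inp⁻ : ∀ {S a t bs′} → ⊑F S a (inp t bs′) →
          ∃[ bs ] (a ≡ inp t bs × (∀ ℓ → ℓ ∈ labs bs′ → ℓ ∈ labs bs) × Conts S bs bs′)
⊑F-inp⁻ (inp⊑ sub k) = _ , refl , sub , k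

⊑F-out⁻ : ∀ {S a t bs′} → ⊑F S a (out t bs′) → ∃[ bs ] (a ≡ out t bs × SameLabels bs bs′ × Conts S bs bs′)
⊑F-out⁻ (out⊑ sl k) = _ , refl , sl , k

⊑F-≈F : ∀ {S S′ : Proc → Proc → Set₁} {R : Proc → Proc → Set} {a c b} →
        (∀ {A C B} → S A C → R C B → S′ A B) → ⊑F S a c → ≈F R c b → ⊑F S′ a b
⊑F-≈F _ 𝟎⊑ 𝟎≈ = 𝟎⊑
⊑F-≈F compose (inp⊑ sub k) (inp≈ (_ , bs″⊆bs′) k′) =
  inp⊑ (λ ℓ m → sub ℓ (bs″⊆bs′ ℓ m))
       (λ mA mB → let C , mC = branch-with-label (bs″⊆bs′ _ (label∈labs mB))
                  in compose (k mA mC) (k′ _ _ _ mC mB))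
⊑F-≈F compose (out⊑ (bs⊆bs′ , bs′⊆bs) k) (out≈ (bs′⊆bs″ , bs″⊆bs′) k′) =
  out⊑ ((λ ℓ m → bs′⊆bs″ ℓ (bs⊆bs′ ℓ m)) , (λ ℓ m → bs′⊆bs ℓ (bs″⊆bs′ ℓ m)))
       (λ mA mB → let C , mC = branch-with-label (bs″⊆bs′ _ (label∈labs mB))
                  in compose (k mA mC) (k′ _ _ _ mC mB))

-- Needed for merged projections, whose branches are only bisimilar to
-- those of the merge.
⊑-restrict-inp : ∀ {P Q Q′ s bs bs′} → P ⊑ Q → root Q ≡ inp s bs → root Q′ ≡ inp s bs′ →
                 (∀ ℓ → ℓ ∈ labs bs′ → ℓ ∈ labs bs) →
                 (∀ ℓ A B → (ℓ , A) ∈ bs → (ℓ , B) ∈ bs′ → A ≈P B) → P ⊑ Q′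
⊑-restrict-inp {Q = Q} {Q′ = Q′} (S , s₀ , closed) rootQ rootQ′ bs′⊆bs bisim =
  S′ , (Q , s₀ , inj₁ (refl , refl)) , closed′
  where
  S′ : Proc → Proc → Set₁
  S′ A B = Σ[ C ∈ Proc ] (S A C × ((C ≡ Q × B ≡ Q′) ⊎ C ≈P B))

  closed′ : ∀ {A B} → S′ A B → ⊑F S′ (root A) (root B)
  closed′ {A} (C , sAC , inj₁ (refl , refl))
    with ⊑F-inp⁻ (subst (⊑F S (root A)) rootQ (closed sAC))
  ... | _ , rootA , sub , k rewrite rootA | rootQ′ =
    inp⊑ (λ ℓ m → sub ℓ (bs′⊆bs ℓ m))
         (λ mA mB → let C′ , mC = branch-with-label (bs′⊆bs _ (label∈labs mB))
                    in C′ , k mA mC , inj₂ (bisim _ _ _ mC mB))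
  closed′ (C , sAC , inj₂ (R , rCB , bisimR)) =
    ⊑F-≈F (λ {_} {C′} sAC′ rC′B′ → C′ , sAC′ , inj₂ (R , rC′B′ , bisimR)) (closed sAC) (bisimR _ _ rCB)

-- Global types are generalised to arbitrary coalgebras δ : X → GNode X,
-- because the global type of a reduced session is not a subtree of G.
module _ {X : Set} (δ : X → GNode X) where

  data PtNode (u : Part) : GNode X → Set where
    sender   : ∀ {t bs} → PtNode u (com u t bs)
    receiver : ∀ {r bs} → PtNode u (com r u bs)
    below    : ∀ {r t bs ℓ y} → (ℓ , y) ∈ bs → PtNode u (δ y) → PtNode u (com r t bs)

  Pt : Part → X → Set
  Pt u y = PtNode u (δ y)

  -- One unfolding of "P is below the projection of the node onto u",
  -- with projection and the structural preorder fused into one relation.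
  data ConformsF (u : Part) (R : X → Proc → Set₂) : GNode X → Proc → Set₂ where
    c-𝟎    : ∀ {n P} → root P ≡ 𝟎 → ¬ PtNode u n → ConformsF u R n P
    c-out  : ∀ {t bs P bsP} → root P ≡ out t bsP → SameLabels bs bsP → Conts R bs bsP →
             ConformsF u R (com u t bs) P
    c-inp  : ∀ {r bs P bsP} → root P ≡ inp r bsP → (∀ ℓ → ℓ ∈ labs bs → ℓ ∈ labs bsP) → Conts R bs bsP →
             ConformsF u R (com r u bs) P
    c-skip : ∀ {r t bs P} → u ≢ r → u ≢ t → PtNode u (com r t bs) → Branches (λ y → R y P) bs →
             ConformsF u R (com r t bs) P

  Closed : Part → (X → Proc → Set₂) → Set₂
  Closed u R = ∀ {y P} → R y P → ConformsF u R (δ y) P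

  record Conforms (u : Part) (x : X) (P : Proc) : Set₃ where
    constructor conforms
    field
      relation : X → Proc → Set₂
      holds    : relation x P
      closed   : Closed u relation

    unfold : ConformsF u relation (δ x) P
    unfold = closed holds

    at : ∀ {n} → δ x ≡ n → ConformsF u relation n P
    at e = subst (λ n → ConformsF u relation n P) e unfold

  node-at : ∀ {u R y n P} → δ y ≡ n → ConformsF u R n P → ConformsF u R (δ y) P
  node-at {u} {R} {P = P} e = subst (λ n → ConformsF u R n P) (sym e)

  nonzero⇒Pt : ∀ {u R n P} → ConformsF u R n P → ¬ root P ≡ 𝟎 → PtNode u n
  nonzero⇒Pt (c-𝟎 z _)          nz = ⊥-elim (nz z)
  nonzero⇒Pt (c-out _ _ _)      _  = sender
  nonzero⇒Pt (c-inp _ _ _)      _  = receiver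
  nonzero⇒Pt (c-skip _ _ pt _)  _  = pt

  Pt⇒nonzero : ∀ {u R y P} → Closed u R → R y P → Pt u y → ¬ root P ≡ 𝟎
  Pt⇒nonzero {y = y} cl r pt z with δ y | cl r | pt
  ... | _ | c-𝟎 _ ¬pt            | pt′            = ¬pt pt′
  ... | _ | c-out rootP _ _      | _              = 𝟎≢out (trans (sym z) rootP)
  ... | _ | c-inp rootP _ _      | _              = 𝟎≢inp (trans (sym z) rootP)
  ... | _ | c-skip u≢u _ _ _     | sender         = u≢u refl
  ... | _ | c-skip _ u≢u _ _     | receiver       = u≢u refl
  ... | _ | c-skip _ _ _ k       | below m pt′    = Pt⇒nonzero cl (k m) pt′ z

  𝟎-conforms : ∀ {u x P} → root P ≡ 𝟎 → ¬ Pt u x → Conforms u x P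
  𝟎-conforms {u} z ¬pt = conforms (λ y P → Lift _ (root P ≡ 𝟎 × ¬ Pt u y)) (lift (z , ¬pt))
                                  (λ (lift (z′ , ¬pt′)) → c-𝟎 z′ ¬pt′)

  conforms-end : ∀ {u R P} → ConformsF u R end P → root P ≡ 𝟎
  conforms-end (c-𝟎 z _) = z

  conforms-sender : ∀ {u R t bs P} → ¬ u ∈pt P → ConformsF u R (com u t bs) P →
                    ∃[ bsP ] (root P ≡ out t bsP × SameLabels bs bsP × Conts R bs bsP)
  conforms-sender _    (c-𝟎 _ ¬pt)        = ⊥-elim (¬pt sender)
  conforms-sender _    (c-out rootP sl k) = _ , rootP , sl , k
  conforms-sender ¬self (c-inp rootP _ _) = ⊥-elim (¬self (here-inp rootP))
  conforms-sender _    (c-skip u≢u _ _ _) = ⊥-elim (u≢u refl)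

  conforms-receiver : ∀ {u R r bs P} → ¬ u ∈pt P → ConformsF u R (com r u bs) P →
                      ∃[ bsP ] (root P ≡ inp r bsP × (∀ ℓ → ℓ ∈ labs bs → ℓ ∈ labs bsP) × Conts R bs bsP)
  conforms-receiver _     (c-𝟎 _ ¬pt)         = ⊥-elim (¬pt receiver)
  conforms-receiver ¬self (c-out rootP _ _)   = ⊥-elim (¬self (here-out rootP))
  conforms-receiver _     (c-inp rootP sub k) = _ , rootP , sub , k
  conforms-receiver _     (c-skip _ u≢u _ _)  = ⊥-elim (u≢u refl)

  conforms-bystander : ∀ {u R r t bs P ℓ y} → Closed u R → u ≢ r → u ≢ t →
                       ConformsF u R (com r t bs) P → (ℓ , y) ∈ bs → Conforms u y P
  conforms-bystander _  _   _   (c-𝟎 z ¬pt)       m = 𝟎-conforms z (¬pt ∘ below m)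
  conforms-bystander _  u≢u _   (c-out _ _ _)     _ = ⊥-elim (u≢u refl)
  conforms-bystander _  _   u≢u (c-inp _ _ _)     _ = ⊥-elim (u≢u refl)
  conforms-bystander cl _   _   (c-skip _ _ _ k)  m = conforms _ (k m) cl

∈ptG⇒Pt : ∀ {u G} → u ∈ptG G → Pt groot u G
∈ptG⇒Pt (here-snd e)  = subst (PtNode groot _) (sym e) sender
∈ptG⇒Pt (here-rcv e)  = subst (PtNode groot _) (sym e) receiver
∈ptG⇒Pt (there e m p) = subst (PtNode groot _) (sym e) (below m (∈ptG⇒Pt p))

Pt⇒∈ptG : ∀ {u G} → Pt groot u G → u ∈ptG G
Pt⇒∈ptG = from refl
  where
  from : ∀ {u G n} → groot G ≡ n → PtNode groot u n → u ∈ptG G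
  from e sender        = here-snd e
  from e receiver      = here-rcv e
  from e (below m pt)  = there e m (from refl pt)

module _ (u : Part) (Rp : GT → Proc → Set) (projects : ∀ G P → Rp G P → ProjF u Rp G P) where

  Refines : GT → Proc → Set₂
  Refines G P = Σ[ Q ∈ Proc ] (Rp G Q × P ⊑ Q)

  refines-closed : Closed groot u Refines
  refines-closed {G} {P} (Q , rGQ , (S , sPQ , closedS)) with projects G Q rGQ
  ... | proj-none ∉G rootQ =
    c-𝟎 (⊑F-𝟎 (subst (⊑F S (root P)) rootQ (closedS sPQ))) (∉G ∘ Pt⇒∈ptG)
  ... | proj-snd e rootQ (bs⊆bsQ , bsQ⊆bs) k
    with ⊑F-out⁻ (subst (⊑F S (root P)) rootQ (closedS sPQ))
  ... | _ , rootP , (bsP⊆bsQ , bsQ⊆bsP) , kS =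
    node-at groot e
      (c-out rootP ((λ ℓ m → bsQ⊆bsP ℓ (bs⊆bsQ ℓ m)) , (λ ℓ m → bsQ⊆bs ℓ (bsP⊆bsQ ℓ m)))
             (λ my mA → let B , mB = branch-with-label (bs⊆bsQ _ (label∈labs my))
                        in B , k _ _ _ my mB , (S , kS mA mB , closedS)))
  refines-closed {P = P} (_ , _ , (S , sPQ , closedS)) | proj-rcv e rootQ (bs⊆bsQ , _) k
    with ⊑F-inp⁻ (subst (⊑F S (root P)) rootQ (closedS sPQ))
  ... | _ , rootP , bsQ⊆bsP , kS =
    node-at groot e
      (c-inp rootP (λ ℓ m → bsQ⊆bsP ℓ (bs⊆bsQ ℓ m))
             (λ my mA → let B , mB = branch-with-label (bs⊆bsQ _ (label∈labs my))
                        in B , k _ _ _ my mB , (S , kS mA mB , closedS)))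
  refines-closed (Q , _ , P⊑Q) | proj-same e u≢r u≢t ∈G k =
    node-at groot e (c-skip u≢r u≢t (subst (PtNode groot u) e (∈ptG⇒Pt ∈G)) (λ my → Q , k _ _ my , P⊑Q))
  refines-closed {P = P} (_ , _ , P⊑Q)
    | proj-merge {bs = bs} e u≢r u≢t ∈G rootQ Ps Λ rPs rootPs _ _ Λ⊆bsQ bisim =
    node-at groot e (c-skip u≢r u≢t (subst (PtNode groot u) e (∈ptG⇒Pt ∈G)) refines-branch)
    where
    refines-branch : Branches (λ y → Refines y P) bs
    refines-branch m =
      Ps i , subst (λ z → Rp z (Ps i)) (sym (cong proj₂ (lookup-index m))) (rPs i) ,
      ⊑-restrict-inp P⊑Q rootQ (rootPs i) (Λ⊆bsQ i) (bisim i)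
      where i = index m

data UpdateView (M : Session) (p : Part) (P : Proc) (q : Part) (Q : Proc) : Part → Proc → Set where
  at-p  : UpdateView M p P q Q p P
  at-q  : UpdateView M p P q Q q Q
  other : ∀ {u} → u ≢ p → u ≢ q → UpdateView M p P q Q u (M u)

updateView : ∀ M p P q Q u → UpdateView M p P q Q u (update M p P q Q u)
updateView M p P q Q u with u ≟ p | u ≟ q
... | yes refl | _ rewrite dec-true (u ≟ u) refl = at-p
... | no u≢p | yes refl rewrite dec-false (u ≟ p) u≢p | dec-true (u ≟ u) refl = at-q
... | no u≢p | no u≢q rewrite dec-false (u ≟ p) u≢p | dec-false (u ≟ q) u≢q = other u≢p u≢q

NoSelf : Session → Set
NoSelf M = ∀ u → ¬ u ∈pt M u

noSelf-step : ∀ {M p ℓ q M′} → NoSelf M → Step M p ℓ q M′ → NoSelf M′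
noSelf-step {M} {p} {q = q} noSelf (comm {P = P} {Q = Q} _ rootP rootQ mP mQ _) u
  with update M p P q Q u | updateView M p P q Q u
... | _ | at-p      = noSelf p ∘ there-out rootP mP
... | _ | at-q      = noSelf q ∘ there-inp rootQ mQ
... | _ | other _ _  = noSelf u

record WellTypedAt (M : Session) {X : Set} (δ : X → GNode X) (x : X) : Set₃ where
  constructor well-typed
  field
    noSelf   : NoSelf M
    conform  : ∀ u → Conforms δ u x (M u)

WellTyped : Session → Set₃
WellTyped M = Σ[ X ∈ Set ] Σ[ δ ∈ (X → GNode X) ] Σ[ x ∈ X ] WellTypedAt M δ x

typed⇒wellTyped : ∀ {M I G} → IsSession M I → Typed M I G → WellTyped M
typed⇒wellTyped {M} {I} {G} (_ , outside-𝟎 , noSelf-I) (projections , pt⊆I) =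
  GT , groot , G , well-typed noSelf conform
  where
  noSelf : NoSelf M
  noSelf u with u ∈? I
  ... | yes u∈I = noSelf-I u u∈I
  ... | no u∉I  = 𝟎⇒∉pt (outside-𝟎 u u∉I)
  conform : ∀ u → Conforms groot u G (M u)
  conform u with u ∈? I
  ... | no u∉I = 𝟎-conforms groot (outside-𝟎 u u∉I) (u∉I ∘ pt⊆I u ∘ Pt⇒∈ptG)
  ... | yes u∈I with projections u u∈I
  ... | Q , (Rp , rGQ , projects) , M⩽Q =
    conforms (Refines u Rp projects) (Q , rGQ , ⩽⇒⊑ M⩽Q) (refines-closed u Rp projects)

Interacts : Session → Part → Set
Interacts M u = ∃[ r ] ∃[ ℓ ] ∃[ s ] ∃[ M′ ] (Step M r ℓ s M′ × (u ≡ r ⊎ u ≡ s))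

module _ {X : Set} {δ : X → GNode X} where

  open WellTypedAt
  open Conforms

  advance : ∀ {M x r t bs ℓ y} → WellTypedAt M δ x → δ x ≡ com r t bs → (ℓ , y) ∈ bs →
            ∃[ M₁ ] (Step M r ℓ t M₁ × WellTypedAt M₁ δ y)
  advance {M} {r = r} {t} {ℓ = ℓ} {y} wt e m
    with conforms-sender δ (noSelf wt r) (at (conform wt r) e)
       | conforms-receiver δ (noSelf wt t) (at (conform wt t) e)
  ... | bsR , rootR , (bs⊆bsR , bsR⊆bs) , kR | bsT , rootT , bs⊆bsT , kT
    with branch-with-label (bs⊆bsR ℓ (label∈labs m)) | branch-with-label (bs⊆bsT ℓ (label∈labs m))
  ... | R′ , mR | T′ , mT = update M r R′ t T′ , step , well-typed (noSelf-step (noSelf wt) step) conform′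
    where
    r≢t : r ≢ t
    r≢t refl = noSelf wt r (here-out rootR)
    step : Step M r ℓ t (update M r R′ t T′)
    step = comm r≢t rootR rootT mR mT (λ ℓ′ → bs⊆bsT ℓ′ ∘ bsR⊆bs ℓ′)
    conform′ : ∀ u → Conforms δ u y (update M r R′ t T′ u)
    conform′ u with update M r R′ t T′ u | updateView M r R′ t T′ u
    ... | _ | at-p          = conforms _ (kR m mR) (closed (conform wt r))
    ... | _ | at-q          = conforms _ (kT m mT) (closed (conform wt t))
    ... | _ | other u≢r u≢t = conforms-bystander δ (closed (conform wt u)) u≢r u≢t (at (conform wt u) e) m

  some-branch : ∀ {M x r t bs} → WellTypedAt M δ x → δ x ≡ com r t bs → ∃[ ℓ ] ∃[ y ] (ℓ , y) ∈ bs
  some-branch {M} {r = r} wt e with conforms-sender δ (noSelf wt r) (at (conform wt r) e)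
  ... | _ , rootR , (_ , bsR⊆bs) , _ with out-has-branch (M r) rootR
  ... | ℓ , _ , m = ℓ , branch-with-label (bsR⊆bs ℓ (label∈labs m))

  fire : ∀ {M x r t bs} → WellTypedAt M δ x → δ x ≡ com r t bs → ∃[ ℓ ] ∃[ M₁ ] Step M r ℓ t M₁
  fire wt e with some-branch wt e
  ... | ℓ , _ , m with advance wt e m
  ... | M₁ , step , _ = ℓ , M₁ , step

  progress : ∀ {M x} → WellTypedAt M δ x → Terminated M ⊎ ∃[ M′ ] (M ⟶ M′)
  progress {x = x} wt with δ x in e
  ... | end        = inj₁ λ u → conforms-end δ (at (conform wt u) e)
  ... | com r t bs with fire wt e
  ... | ℓ , M₁ , step = inj₂ (M₁ , r , ℓ , t , step)

  Pt⇒interacts : ∀ {M x u} → WellTypedAt M δ x → Pt δ u x → ∃[ M′ ] (M ⟶* M′ × Interacts M′ u)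
  Pt⇒interacts wt = from wt refl
    where
    from : ∀ {M x u n} → WellTypedAt M δ x → δ x ≡ n → PtNode δ u n → ∃[ M′ ] (M ⟶* M′ × Interacts M′ u)
    from {M} wt e sender with fire wt e
    ... | ℓ , M₁ , step = M , ε , _ , ℓ , _ , M₁ , step , inj₁ refl
    from {M} wt e receiver with fire wt e
    ... | ℓ , M₁ , step = M , ε , _ , ℓ , _ , M₁ , step , inj₂ refl
    from wt e (below m pt) with advance wt e m
    ... | M₁ , step , wt₁ with from wt₁ refl pt
    ... | M′ , steps , interacts = M′ , (_ , _ , _ , step) ◅ steps , interacts

data Reduct (X : Set) : Set where
  orig : X → Reduct X
  red  : X → Reduct X

-- The reduced global type after the step p ℓ q: red y behaves as y with
-- its first p → q communication on every path replaced by the ℓ-branch,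
-- and orig y as y itself.
module Reduction {X : Set} (δ : X → GNode X) (p q : Part) (ℓ : Label) where

  -- The junk value end (no ℓ-branch) never arises where the step happens.
  hop : List (Label × X) → GNode (Reduct X)
  hop bs = maybe (mapGNode orig ∘ δ) end (select ℓ bs)

  erase : GNode X → GNode (Reduct X)
  erase end = end
  erase (com r t bs) with r ≟ p | t ≟ q
  ... | yes _ | yes _ = hop bs
  ... | _     | _     = com r t (map₂ red bs)

  δʳ : Reduct X → GNode (Reduct X)
  δʳ (orig y) = mapGNode orig (δ y)
  δʳ (red y)  = erase (δ y)

  erase-pq : ∀ {bs} → ℓ ∈ labs bs → ∃[ z ] ((ℓ , z) ∈ bs × erase (com p q bs) ≡ mapGNode orig (δ z))
  erase-pq {bs} m with p ≟ p | q ≟ q | select-complete bs m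
  ... | no p≢p | _      | _ = ⊥-elim (p≢p refl)
  ... | yes _  | no q≢q | _ = ⊥-elim (q≢q refl)
  ... | yes _  | yes _  | z , found , mz rewrite found = z , mz , refl

  erase-apart : ∀ {r t bs} → p ≢ r → erase (com r t bs) ≡ com r t (map₂ red bs)
  erase-apart {r} {t} p≢r with r ≟ p | t ≟ q
  ... | yes refl | _ = ⊥-elim (p≢r refl)
  ... | no _     | _ = refl

  Pt-orig⁻ : ∀ {u} n → PtNode δʳ u (mapGNode orig n) → PtNode δ u n
  Pt-orig⁻ (com _ _ _) sender       = sender
  Pt-orig⁻ (com _ _ _) receiver     = receiver
  Pt-orig⁻ (com _ _ _) (below m pt) with ∈-map₂⁻ orig m
  ... | _ , m′ , refl = below m′ (Pt-orig⁻ _ pt)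

  Pt-orig⁺ : ∀ {u n} → PtNode δ u n → PtNode δʳ u (mapGNode orig n)
  Pt-orig⁺ sender       = sender
  Pt-orig⁺ receiver     = receiver
  Pt-orig⁺ (below m pt) = below (∈-map₂⁺ orig m) (Pt-orig⁺ pt)

  conforms-orig : ∀ {u R R′ n P} → (∀ {y P} → R y P → R′ (orig y) P) →
                  ConformsF δ u R n P → ConformsF δʳ u R′ (mapGNode orig n) P
  conforms-orig {n = n} _ (c-𝟎 z ¬pt) = c-𝟎 z (¬pt ∘ Pt-orig⁻ n)
  conforms-orig {R′ = R′} carry (c-out rootP sl k) =
    c-out rootP (SameLabels-map₂ orig sl) (Conts-map₂ orig {R′ = R′} (λ _ → carry) k)
  conforms-orig {R′ = R′} carry (c-inp rootP sub k) =
    c-inp rootP (labs-map₂⊆ orig sub) (Conts-map₂ orig {R′ = R′} (λ _ → carry) k)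
  conforms-orig {R′ = R′} {P = P} carry (c-skip u≢r u≢t pt k) =
    c-skip u≢r u≢t (Pt-orig⁺ pt) (Branches-map₂ orig {F′ = λ w → R′ w P} (λ _ → carry) k)

is-𝟎 : (n : PNode Proc) → Dec (n ≡ 𝟎)
is-𝟎 𝟎         = yes refl
is-𝟎 (inp _ _) = no λ ()
is-𝟎 (out _ _) = no λ ()

module SubjectReduction {X : Set} {δ : X → GNode X} {M : Session} {x : X} (wt : WellTypedAt M δ x)
  {p q ℓ bsp bsq P Q} (p≢q : p ≢ q) (rootp : root (M p) ≡ out q bsp) (rootq : root (M q) ≡ inp p bsq)
  (mP : (ℓ , P) ∈ bsp) (mQ : (ℓ , Q) ∈ bsq) (bsp⊆bsq : ∀ ℓ′ → ℓ′ ∈ labs bsp → ℓ′ ∈ labs bsq) where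

  open Reduction δ p q ℓ
  open WellTypedAt wt

  Rs : Part → X → Proc → Set₂
  Rs u = Conforms.relation (conform u)

  cls : ∀ u → Closed δ u (Rs u)
  cls u = Conforms.closed (conform u)

  -- The part of the global type above the communication p ℓ q that fires:
  -- the states to which the pre-step processes of p and q still conform.
  Zone : X → Set₂
  Zone y = Rs p y (M p) × Rs q y (M q)

  data Active : Part → Proc → Set where
    sending   : Active p P
    receiving : Active q Q

  active-before : ∀ {v V y} → Active v V → Zone y → Rs v y (M v)
  active-before sending   (zp , _) = zp
  active-before receiving (_ , zq) = zq

  active-nonzero : ∀ {v V} → Active v V → ¬ root (M v) ≡ 𝟎
  active-nonzero sending   z = 𝟎≢out (trans (sym z) rootp)
  active-nonzero receiving z = 𝟎≢inp (trans (sym z) rootq)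

  data ZoneView : GNode X → GNode (Reduct X) → Set₂ where
    at-pq : ∀ {bs z} → (ℓ , z) ∈ bs → (∀ {v V} → Active v V → Rs v z V) →
            ZoneView (com p q bs) (mapGNode orig (δ z))
    apart : ∀ {r t bs} → (∀ {v V} → Active v V → v ≢ r × v ≢ t) → Branches Zone bs →
            ZoneView (com r t bs) (com r t (map₂ red bs))

  -- Since M p outputs to q and M q inputs from p, every state of the zone
  -- is either p → q itself or a communication both of them skip.
  zoneView : ∀ {y} → Zone y → ZoneView (δ y) (erase (δ y))
  zoneView {y} (zp , zq) with δ y | cls p zp | cls q zq
  ... | _ | c-𝟎 z _     | _           = ⊥-elim (active-nonzero sending z)
  ... | _ | _           | c-𝟎 z _     = ⊥-elim (active-nonzero receiving z)
  ... | _ | c-inp e _ _ | _           = ⊥-elim (inp≢out (trans (sym e) rootp))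
  ... | _ | _           | c-out e _ _ = ⊥-elim (inp≢out (trans (sym rootq) e))
  ... | _ | c-out e _ _ | c-skip _ q≢t _ _ = ⊥-elim (q≢t (sym (proj₁ (out-injective (trans (sym e) rootp)))))
  ... | _ | c-skip p≢r _ _ _ | c-inp e _ _ = ⊥-elim (p≢r (sym (proj₁ (inp-injective (trans (sym e) rootq)))))
  ... | _ | c-out e (_ , bsP⊆bs) k | c-inp e′ _ k′
    with out-injective (trans (sym rootp) e) | inp-injective (trans (sym rootq) e′)
  ... | _ , refl | _ , refl with erase-pq (bsP⊆bs ℓ (label∈labs mP))
  ... | z , mz , erased =
    subst (ZoneView _) (sym erased) (at-pq mz λ { sending → k mz mP ; receiving → k′ mz mQ })
  zoneView {y} (zp , zq) | _ | c-skip p≢r p≢t _ k | c-skip q≢r q≢t _ k′ =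
    subst (ZoneView _) (sym (erase-apart p≢r))
          (apart (λ { sending → p≢r , p≢t ; receiving → q≢r , q≢t }) (λ m → k m , k′ m))

  Pt-red⁻ : ∀ {u n e} → ZoneView n e → PtNode δʳ u e → PtNode δ u n
  Pt-red⁻ (at-pq m _)     pt           = below m (Pt-orig⁻ _ pt)
  Pt-red⁻ (apart _ _)     sender       = sender
  Pt-red⁻ (apart _ _)     receiver     = receiver
  Pt-red⁻ (apart _ zones) (below m pt) with ∈-map₂⁻ red m
  ... | _ , m′ , refl = below m′ (Pt-red⁻ (zoneView (zones m′)) pt)

  active-Pt-red⁻ : ∀ {v V n e} → Active v V → ZoneView n e → PtNode δʳ v e → ¬ root V ≡ 𝟎
  active-Pt-red⁻ act (at-pq _ rel)   pt           = Pt⇒nonzero δ (cls _) (rel act) (Pt-orig⁻ _ pt)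
  active-Pt-red⁻ act (apart away _)  sender       = ⊥-elim (proj₁ (away act) refl)
  active-Pt-red⁻ act (apart away _)  receiver     = ⊥-elim (proj₂ (away act) refl)
  active-Pt-red⁻ act (apart _ zones) (below m pt) with ∈-map₂⁻ red m
  ... | _ , m′ , refl = active-Pt-red⁻ act (zoneView (zones m′)) pt

  active-Pt-red⁺ : ∀ {v V n e} → Active v V → ¬ root V ≡ 𝟎 → ZoneView n e → PtNode δ v n → PtNode δʳ v e
  active-Pt-red⁺ act nz (at-pq _ rel)   _            = Pt-orig⁺ (nonzero⇒Pt δ (cls _ (rel act)) nz)
  active-Pt-red⁺ act _  (apart away _)  sender       = ⊥-elim (proj₁ (away act) refl)
  active-Pt-red⁺ act _  (apart away _)  receiver     = ⊥-elim (proj₂ (away act) refl)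
  active-Pt-red⁺ act nz (apart _ zones) (below m pt) =
    below (∈-map₂⁺ red m) (active-Pt-red⁺ act nz (zoneView (zones m)) pt)

  bystander-Pt-red⁺ : ∀ {u V n e} → u ≢ p → u ≢ q → ZoneView n e → PtNode δ u n →
                      ConformsF δ u (Rs u) n V → PtNode δʳ u e
  bystander-Pt-red⁺ _ _ _ pt (c-𝟎 _ ¬pt) = ⊥-elim (¬pt pt)
  bystander-Pt-red⁺ u≢p _ (at-pq _ _) _ (c-out _ _ _) = ⊥-elim (u≢p refl)
  bystander-Pt-red⁺ _ u≢q (at-pq _ _) _ (c-inp _ _ _) = ⊥-elim (u≢q refl)
  bystander-Pt-red⁺ {u} _ _ (at-pq m _) (below m′ pt′) (c-skip _ _ _ k) =
    Pt-orig⁺ (nonzero⇒Pt δ (cls u (k m)) (Pt⇒nonzero δ (cls u) (k m′) pt′))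
  bystander-Pt-red⁺ _ _ (at-pq _ _) sender   (c-skip u≢u _ _ _) = ⊥-elim (u≢u refl)
  bystander-Pt-red⁺ _ _ (at-pq _ _) receiver (c-skip _ u≢u _ _) = ⊥-elim (u≢u refl)
  bystander-Pt-red⁺ _ _ (apart _ _) _ (c-out _ _ _) = sender
  bystander-Pt-red⁺ _ _ (apart _ _) _ (c-inp _ _ _) = receiver
  bystander-Pt-red⁺ _ _ (apart _ _) sender   (c-skip u≢u _ _ _) = ⊥-elim (u≢u refl)
  bystander-Pt-red⁺ _ _ (apart _ _) receiver (c-skip _ u≢u _ _) = ⊥-elim (u≢u refl)
  bystander-Pt-red⁺ {u} u≢p u≢q (apart _ zones) (below m pt) (c-skip _ _ _ k) =
    below (∈-map₂⁺ red m) (bystander-Pt-red⁺ u≢p u≢q (zoneView (zones m)) pt (cls u (k m)))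

  data Role (u : Part) (y : X) (V : Proc) : Set₂ where
    active    : Active u V → Role u y V
    bystander : u ≢ p → u ≢ q → Rs u y V → Role u y V

  Rʳ : Part → Reduct X → Proc → Set₂
  Rʳ u (orig y)  = Rs u y
  Rʳ u (red y) V = Zone y × Role u y V

  active-conforms-red : ∀ {v V n e} → Active v V → ZoneView n e → PtNode δ v n → ConformsF δʳ v (Rʳ v) e V
  active-conforms-red act (at-pq _ rel) _ = conforms-orig (λ r → r) (cls _ (rel act))
  active-conforms-red {V = V} act view@(apart away zones) pt with is-𝟎 (root V)
  ... | yes z  = c-𝟎 z (λ pt′ → active-Pt-red⁻ act view pt′ z)
  ... | no nz  = c-skip (proj₁ (away act)) (proj₂ (away act)) (active-Pt-red⁺ act nz view pt)
                        (Branches-map₂ red {F′ = λ w → Rʳ _ w V} (λ _ zone → zone , active act) zones)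

  bystander-conforms-red : ∀ {u V n e} → u ≢ p → u ≢ q → ZoneView n e →
                           ConformsF δ u (Rs u) n V → ConformsF δʳ u (Rʳ u) e V
  bystander-conforms-red _ _ view (c-𝟎 z ¬pt) = c-𝟎 z (¬pt ∘ Pt-red⁻ view)
  bystander-conforms-red u≢p _ (at-pq _ _) (c-out _ _ _) = ⊥-elim (u≢p refl)
  bystander-conforms-red _ u≢q (at-pq _ _) (c-inp _ _ _) = ⊥-elim (u≢q refl)
  bystander-conforms-red {u} _ _ (at-pq m _) (c-skip _ _ _ k) = conforms-orig (λ r → r) (cls u (k m))
  bystander-conforms-red {u} u≢p u≢q (apart _ zones) (c-out rootV sl k) =
    c-out rootV (SameLabels-map₂ red sl) (Conts-map₂ red {R′ = Rʳ u} (λ m r → zones m , bystander u≢p u≢q r) k)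
  bystander-conforms-red {u} u≢p u≢q (apart _ zones) (c-inp rootV sub k) =
    c-inp rootV (labs-map₂⊆ red sub) (Conts-map₂ red {R′ = Rʳ u} (λ m r → zones m , bystander u≢p u≢q r) k)
  bystander-conforms-red {u} {V} u≢p u≢q view@(apart _ zones) c@(c-skip u≢r u≢t pt k) =
    c-skip u≢r u≢t (bystander-Pt-red⁺ u≢p u≢q view pt c)
           (Branches-map₂ red {F′ = λ w → Rʳ u w V} (λ m r → zones m , bystander u≢p u≢q r) k)

  closedʳ : ∀ u → Closed δʳ u (Rʳ u)
  closedʳ u {orig y} r = conforms-orig (λ r → r) (cls u r)
  closedʳ u {red y} (zone , active act) =
    active-conforms-red act (zoneView zone) (nonzero⇒Pt δ (cls u (active-before act zone)) (active-nonzero act))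
  closedʳ u {red y} (zone , bystander u≢p u≢q r) = bystander-conforms-red u≢p u≢q (zoneView zone) (cls u r)

  reduced : WellTypedAt (update M p P q Q) δʳ (red x)
  reduced = well-typed (noSelf-step noSelf (comm p≢q rootp rootq mP mQ bsp⊆bsq))
                       (λ u → conforms (Rʳ u) (zone₀ , role u) (λ {y} → closedʳ u {y}))
    where
    zone₀ : Zone x
    zone₀ = Conforms.holds (conform p) , Conforms.holds (conform q)
    role : ∀ u → Role u x (update M p P q Q u)
    role u with update M p P q Q u | updateView M p P q Q u
    ... | _ | at-p          = active sending
    ... | _ | at-q          = active receiving
    ... | _ | other u≢p u≢q = bystander u≢p u≢q (Conforms.holds (conform u))

subject-reduction : ∀ {M M′} → WellTyped M → M ⟶ M′ → WellTyped M′
subject-reduction (_ , _ , _ , wt) (_ , _ , _ , comm p≢q rootp rootq mP mQ sub) =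
  _ , _ , _ , SubjectReduction.reduced wt p≢q rootp rootq mP mQ sub

subject-reduction* : ∀ {M M′} → WellTyped M → M ⟶* M′ → WellTyped M′
subject-reduction* wt ε              = wt
subject-reduction* wt (step ◅ steps) = subject-reduction* (subject-reduction wt step) steps

-- Finite
-- weight would only be needed to make every fair run reach it.
mainTheorem3 : (M : Session) (I : List Part) (G : GT) →
    IsSession M I → WellFormed G → Typed M I G → LockFree M
mainTheorem3 M I G session _ typed = no-deadlock , no-starvation
  where
  typable : ∀ {M′} → M ⟶* M′ → WellTyped M′
  typable = subject-reduction* (typed⇒wellTyped session typed)

  no-deadlock : ∀ M′ → M ⟶* M′ → Terminated M′ ⊎ ∃[ M″ ] (M′ ⟶ M″)
  no-deadlock _ steps with typable steps
  ... | _ , _ , _ , wt = progress wt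

  no-starvation : ∀ M′ u → M ⟶* M′ → ¬ root (M′ u) ≡ 𝟎 → ∃[ M″ ] (M′ ⟶* M″ × Interacts M″ u)
  no-starvation _ u steps nz with typable steps
  ... | _ , δ , _ , wt = Pt⇒interacts wt (nonzero⇒Pt δ (Conforms.unfold (WellTypedAt.conform wt u)) nz)
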